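{- For integers $\ell,m,n$ let $p_{\ell,m,2n}$ denote the weighted number of paths from $(\ell,m)$ to $(2n,0)$ (as defined in the context). Then \[ \frac{p_{\ell,j,2n}}{j+1}\ge\frac{p_{\ell,k,2n}}{k+1} \] for all integers $0\le j<k\le\ell\le 2n$ with $k-j$ even.
   Context: The paths considered use steps $U=(1,1)$ and $D=(1,-1)$ and never visit a point with negative $y$-coordinate. A step $U$ starting at $(a,b)$ has weight $(a-b+2)/(a+b+2)$, a step $D$ has weight $1$, and the weight of a path is the product of its step weights. $p_{\ell,m,2n}$ is the sum of the weights of all such paths starting at $(\ell,m)$ and ending at $(2n,0)$. -}

module Defs where

open import Data.Nat as ℕ using (ℕ; zero; suc; _+_; _∸_; _≤?_)
open import Data.Integer as ℤ using (ℤ; +_)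
open import Data.Rational as ℚ using (ℚ; _/_; 0ℚ; 1ℚ)
open import Data.List using (List; []; _∷_; map; concatMap)
open import Data.Maybe using (Maybe; just; nothing)
open import Data.Product using (_×_; _,_)
open import Relation.Nullary using (yes; no)

-- Steps U = (1,1), D = (1,-1).
data Step : Set where
  U D : Step

weightU : ℕ → ℕ → ℚ
weightU a b = ((+ a ℤ.- + b) ℤ.+ + 2) / suc (suc (a + b))

-- Follow a step sequence from (a,b).  Returns the total weight and the
-- final height, or nothing if the path visits a point with negative y.
walk : ℕ → ℕ → List Step → Maybe (ℚ × ℕ)
walk a b [] = just (1ℚ , b)
walk a b (U ∷ s) with walk (suc a) (suc b) s
... | nothing = nothing
... | just (w , h) = just (weightU a b ℚ.* w , h)
walk a zero (D ∷ s) = nothing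
walk a (suc b) (D ∷ s) = walk (suc a) b s

allSeqs : ℕ → List (List Step)
allSeqs zero = [] ∷ []
allSeqs (suc r) = concatMap (λ s → (U ∷ s) ∷ (D ∷ s) ∷ []) (allSeqs r)

contrib : ℕ → ℕ → List Step → ℚ
contrib a b s with walk a b s
... | nothing = 0ℚ
... | just (w , zero) = w
... | just (w , suc _) = 0ℚ

sumℚ : List ℚ → ℚ
sumℚ [] = 0ℚ
sumℚ (x ∷ xs) = x ℚ.+ sumℚ xs

-- p ℓ m N : sum of weights of all paths from (ℓ,m) to (N,0) with y ≥ 0.
-- (The paper's p_{ℓ,m,2n} is  p ℓ m (2 * n).)
p : ℕ → ℕ → ℕ → ℚ
p ℓ m N with ℓ ≤? N
... | yes _ = sumℚ (map (contrib ℓ m) (allSeqs (N ∸ ℓ)))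
... | no _ = 0ℚ

module Submission where

-- Paths from (a , b) are tracked by their length r, their starting height b
-- and their excess d = a - b, which a U step preserves and a D step raises
-- by 2.  With S r a b the weighted number of paths of length r from (a , b)
-- ending at height 0, the normalised sums  Q r d b = S r (b + d) b / (b + 1)
-- obey the first-step recursion
--     Q (r + 1) d b = α d b · Q r d (b + 1) + β b · Q r (d + 2) (b - 1)
-- with explicit nonnegative coefficients α, β (the second term is absent for
-- b = 0).  The heart of the proof is the comparison
--     Q r d (b + 2) ≤ Q r (d + 2) b
-- of two starting points with the same abscissa, proved by induction on r:
-- the inductive step needs only Q ≥ 0 and the coefficient inequality
-- α d (b + 2) + β (b + 2) ≤ α (d + 2) b + β b, which holds because
-- α d b + β b equals a closed form γ (b + d) b that is decreasing in b.
-- Iterating the comparison along j, j + 2, …, k gives lemma4p5.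

open import Defs
open import Data.Nat using (ℕ; suc; _∸_; _*_; _≤_; _<_)
open import Data.Nat.Divisibility using (_∣_)
open import Data.Rational using (ℚ; _/_) renaming (_≤_ to _≤ℚ_; _*_ to _*ℚ_)
open import Data.Integer using (+_)

open import Algebra.Bundles using (CommutativeRing)
open import Data.Nat as ℕ using (zero; _+_)
import Data.Nat.Properties as ℕP
open import Data.Nat.Tactic.RingSolver using (solve-∀)
open import Data.Nat.Divisibility using (divides)
import Data.Integer as ℤ
import Data.Integer.Properties as ℤP
import Data.Integer.Tactic.RingSolver as ℤ-Solver
open import Data.Rational using (0ℚ; toℚᵘ) renaming (_+_ to _+ℚ_)
import Data.Rational.Properties as ℚP
open import Data.Rational.Unnormalised as Qu
  using (ℚᵘ; 0ℚᵘ; 1ℚᵘ; *≡*; *≤*; _≃_; NonNegative)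
  renaming (_+_ to _+ᵘ_; _*_ to _*ᵘ_; _≤_ to _≤ᵘ_)
import Data.Rational.Unnormalised.Properties as QuP
open import Data.List using (List; []; _∷_; map; concatMap)
open import Data.Maybe using (just; nothing)
open import Data.Product using (_,_)
open import Function using (_∘_)
open import Relation.Binary.PropositionalEquality
open import Relation.Nullary using (yes; no)
open import Data.Empty using (⊥-elim)

import Algebra.Properties.CommutativeSemigroup as CommutativeSemigroupProperties

module ℚ+ = CommutativeSemigroupProperties
  (CommutativeRing.+-commutativeSemigroup ℚP.+-*-commutativeRing)
module ℚᵘ* = CommutativeSemigroupProperties
  (CommutativeRing.*-commutativeSemigroup QuP.+-*-commutativeRing)

infixl 8 _//_
_//_ : ℕ → (n : ℕ) → .{{ℕ.NonZero n}} → ℚᵘ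
m // n = + m Qu./ n

ι : ℕ → ℚᵘ
ι n = n // 1

//-≃ : ∀ {m n d e} .{{_ : ℕ.NonZero d}} .{{_ : ℕ.NonZero e}} →
       m * e ≡ n * d → m // d ≃ n // e
//-≃ {m} {n} {suc d} {suc e} eq =
  *≡* (trans (sym (ℤP.pos-* m (suc e))) (trans (cong +_ eq) (ℤP.pos-* n (suc d))))

//-≤ : ∀ {m n d e} .{{_ : ℕ.NonZero d}} .{{_ : ℕ.NonZero e}} →
       m * e ≤ n * d → m // d ≤ᵘ n // e
//-≤ {m} {n} {suc d} {suc e} le =
  *≤* (subst₂ ℤ._≤_ (ℤP.pos-* m (suc e)) (ℤP.pos-* n (suc d)) (ℤ.+≤+ le))

//-+ : ∀ m n d e .{{_ : ℕ.NonZero d}} .{{_ : ℕ.NonZero e}} →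
       m // d +ᵘ n // e ≃ ((m * e + n * d) // (d * e)) {{ℕP.m*n≢0 d e}}
//-+ m n (suc d) (suc e) = QuP.≃-reflexive (cong (λ z → z Qu./ (suc d * suc e)) (sym (begin
  + (m * suc e + n * suc d)           ≡⟨ ℤP.pos-+ (m * suc e) (n * suc d) ⟩
  + (m * suc e) ℤ.+ + (n * suc d)     ≡⟨ cong₂ ℤ._+_ (ℤP.pos-* m (suc e)) (ℤP.pos-* n (suc d)) ⟩
  + m ℤ.* + suc e ℤ.+ + n ℤ.* + suc d ∎)))
  where open ≡-Reasoning

//-* : ∀ m n d e .{{_ : ℕ.NonZero d}} .{{_ : ℕ.NonZero e}} →
       m // d *ᵘ n // e ≃ ((m * n) // (d * e)) {{ℕP.m*n≢0 d e}}
//-* m n (suc d) (suc e) =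
  QuP.≃-reflexive (cong (λ z → z Qu./ (suc d * suc e)) (sym (ℤP.pos-* m n)))

-- Weight of a U step from (b + d , b):  (d + 2) / (2b + d + 2).
upWeight : ℕ → ℕ → ℚᵘ
upWeight d b = (2 + d) // (2 + (b + d) + b)

-- Coefficient of the U term after normalising by the heights:
-- upWeight d b · (b + 2) / (b + 1).
α : ℕ → ℕ → ℚᵘ
α d b = ((2 + d) * (2 + b)) // ((2 + (b + d) + b) * (1 + b))

-- Coefficient of the D term after normalising by the heights: b / (b + 1).
β : ℕ → ℚᵘ
β b = b // (1 + b)

-- Closed form of α + β at abscissa a and height b:
-- 2 ((a + 1)(b + 1) + 1) / ((a + b + 2)(b + 1)).
γ : ℕ → ℕ → ℚᵘ
γ a b = (2 * ((1 + a) * (1 + b) + 1)) // ((2 + a + b) * (1 + b))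

-- Raising the excess by two is the same as raising the abscissa by two.
excess-shift : ∀ b d → 2 + (b + d) ≡ b + (2 + d)
excess-shift = solve-∀

α+β≃γ : ∀ d b → α d b +ᵘ β b ≃ γ (b + d) b
α+β≃γ d b = QuP.≃-trans
  (//-+ ((2 + d) * (2 + b)) b ((2 + (b + d) + b) * (1 + b)) (1 + b))
  (//-≃ (cross d b))
  where
  cross : ∀ d b →
    ((2 + d) * (2 + b) * (1 + b) + b * ((2 + (b + d) + b) * (1 + b)))
      * ((2 + (b + d) + b) * (1 + b))
    ≡ 2 * ((1 + (b + d)) * (1 + b) + 1) * ((2 + (b + d) + b) * (1 + b) * (1 + b))
  cross = solve-∀

γ-antitone : ∀ a b → γ a (2 + b) ≤ᵘ γ a b
γ-antitone a b = //-≤ (begin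
  lhs           ≤⟨ ℕP.m≤m+n lhs gap ⟩
  lhs + gap     ≡⟨ cross a b ⟨
  rhs           ∎)
  where
  open ℕP.≤-Reasoning
  lhs rhs gap : ℕ
  lhs = 2 * ((1 + a) * (3 + b) + 1) * ((2 + a + b) * (1 + b))
  rhs = 2 * ((1 + a) * (1 + b) + 1) * ((2 + a + (2 + b)) * (3 + b))
  gap = 4 * ((2 + a + b) + ((1 + a) * (1 + b) + 1) * (3 + b))
  cross : ∀ a b →
    2 * ((1 + a) * (1 + b) + 1) * ((2 + a + (2 + b)) * (3 + b))
    ≡ 2 * ((1 + a) * (3 + b) + 1) * ((2 + a + b) * (1 + b))
      + 4 * ((2 + a + b) + ((1 + a) * (1 + b) + 1) * (3 + b))
  cross = solve-∀

coefficient-inequality : ∀ d b → α d (2 + b) +ᵘ β (2 + b) ≤ᵘ α (2 + d) b +ᵘ β b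
coefficient-inequality d b = begin
  α d (2 + b) +ᵘ β (2 + b)  ≃⟨ α+β≃γ d (2 + b) ⟩
  γ (2 + (b + d)) (2 + b)   ≡⟨ cong (λ a → γ a (2 + b)) (excess-shift b d) ⟩
  γ (b + (2 + d)) (2 + b)   ≤⟨ γ-antitone (b + (2 + d)) b ⟩
  γ (b + (2 + d)) b         ≃⟨ α+β≃γ (2 + d) b ⟨
  α (2 + d) b +ᵘ β b        ∎
  where open QuP.≤-Reasoning

*-nonNeg : ∀ u .{{_ : NonNegative u}} {y} → 0ℚᵘ ≤ᵘ y → 0ℚᵘ ≤ᵘ u *ᵘ y
*-nonNeg u 0≤y = QuP.≤-respˡ-≃ (QuP.*-zeroʳ u) (QuP.*-monoʳ-≤-nonNeg u 0≤y)

mix-≤ : ∀ {u′ v′ u v x y z} .{{_ : NonNegative u′}} .{{_ : NonNegative v′}}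
        .{{_ : NonNegative v}} →
        u′ +ᵘ v′ ≤ᵘ u +ᵘ v → 0ℚᵘ ≤ᵘ y → z ≤ᵘ y → y ≤ᵘ x →
        u′ *ᵘ z +ᵘ v′ *ᵘ y ≤ᵘ u *ᵘ y +ᵘ v *ᵘ x
mix-≤ {u′} {v′} {u} {v} {x} {y} {z} total 0≤y z≤y y≤x = begin
  u′ *ᵘ z +ᵘ v′ *ᵘ y   ≤⟨ QuP.+-monoˡ-≤ (v′ *ᵘ y) (QuP.*-monoʳ-≤-nonNeg u′ z≤y) ⟩
  u′ *ᵘ y +ᵘ v′ *ᵘ y   ≃⟨ QuP.*-distribʳ-+ y u′ v′ ⟨
  (u′ +ᵘ v′) *ᵘ y      ≤⟨ QuP.*-monoˡ-≤-nonNeg y {{Qu.nonNegative 0≤y}} total ⟩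
  (u +ᵘ v) *ᵘ y        ≃⟨ QuP.*-distribʳ-+ y u v ⟩
  u *ᵘ y +ᵘ v *ᵘ y     ≤⟨ QuP.+-monoʳ-≤ (u *ᵘ y) (QuP.*-monoʳ-≤-nonNeg v y≤x) ⟩
  u *ᵘ y +ᵘ v *ᵘ x     ∎
  where open QuP.≤-Reasoning

module _ {A : Set} where

  sum-cong : ∀ {f g : A → ℚ} xs → (∀ x → f x ≡ g x) → sumℚ (map f xs) ≡ sumℚ (map g xs)
  sum-cong []       f≗g = refl
  sum-cong (x ∷ xs) f≗g = cong₂ _+ℚ_ (f≗g x) (sum-cong xs f≗g)

  sum-scale : ∀ w (f : A → ℚ) xs → sumℚ (map (λ x → w *ℚ f x) xs) ≡ w *ℚ sumℚ (map f xs)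
  sum-scale w f []       = sym (ℚP.*-zeroʳ w)
  sum-scale w f (x ∷ xs) =
    trans (cong (w *ℚ f x +ℚ_) (sum-scale w f xs)) (sym (ℚP.*-distribˡ-+ w (f x) _))

  sum-zero : ∀ (xs : List A) → sumℚ (map (λ _ → 0ℚ) xs) ≡ 0ℚ
  sum-zero []       = refl
  sum-zero (x ∷ xs) = trans (ℚP.+-identityˡ _) (sum-zero xs)

  sum-pairs : ∀ {B : Set} (f : B → ℚ) (g h : A → B) xs →
    sumℚ (map f (concatMap (λ x → g x ∷ h x ∷ []) xs))
    ≡ sumℚ (map (f ∘ g) xs) +ℚ sumℚ (map (f ∘ h) xs)
  sum-pairs f g h []       = refl
  sum-pairs f g h (x ∷ xs) = begin
    f (g x) +ℚ (f (h x) +ℚ rest)     ≡⟨ cong (λ z → f (g x) +ℚ (f (h x) +ℚ z)) (sum-pairs f g h xs) ⟩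
    f (g x) +ℚ (f (h x) +ℚ (G +ℚ H)) ≡⟨ cong (f (g x) +ℚ_) (ℚ+.x∙yz≈y∙xz (f (h x)) G H) ⟩
    f (g x) +ℚ (G +ℚ (f (h x) +ℚ H)) ≡⟨ ℚP.+-assoc (f (g x)) G _ ⟨
    (f (g x) +ℚ G) +ℚ (f (h x) +ℚ H) ∎
    where
    open ≡-Reasoning
    rest G H : ℚ
    rest = sumℚ (map f (concatMap (λ x → g x ∷ h x ∷ []) xs))
    G = sumℚ (map (f ∘ g) xs)
    H = sumℚ (map (f ∘ h) xs)

S : ℕ → ℕ → ℕ → ℚ
S r a b = sumℚ (map (contrib a b) (allSeqs r))

contrib-U : ∀ a b s → contrib a b (U ∷ s) ≡ weightU a b *ℚ contrib (suc a) (suc b) s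
contrib-U a b s with walk (suc a) (suc b) s
... | nothing          = sym (ℚP.*-zeroʳ (weightU a b))
... | just (_ , zero)  = refl
... | just (_ , suc _) = sym (ℚP.*-zeroʳ (weightU a b))

contrib-D : ∀ a b s → contrib a (suc b) (D ∷ s) ≡ contrib (suc a) b s
contrib-D a b s with walk (suc a) b s
... | nothing          = refl
... | just (_ , zero)  = refl
... | just (_ , suc _) = refl

S-split : ∀ r a b → S (suc r) a b
  ≡ weightU a b *ℚ S r (suc a) (suc b) +ℚ sumℚ (map (λ s → contrib a b (D ∷ s)) (allSeqs r))
S-split r a b = trans (sum-pairs (contrib a b) (U ∷_) (D ∷_) (allSeqs r))
  (cong (_+ℚ sumℚ (map (λ s → contrib a b (D ∷ s)) (allSeqs r)))
        (trans (sum-cong (allSeqs r) (contrib-U a b))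
               (sum-scale (weightU a b) (contrib (suc a) (suc b)) (allSeqs r))))

-- From height 0 the first step must go up.
S-ground : ∀ r a → S (suc r) a 0 ≡ weightU a 0 *ℚ S r (suc a) 1
S-ground r a = trans (S-split r a 0)
  (trans (cong (weightU a 0 *ℚ S r (suc a) 1 +ℚ_) (sum-zero (allSeqs r))) (ℚP.+-identityʳ _))

S-step : ∀ r a b → S (suc r) a (suc b)
  ≡ weightU a (suc b) *ℚ S r (suc a) (2 + b) +ℚ S r (suc a) b
S-step r a b = trans (S-split r a (suc b))
  (cong (weightU a (suc b) *ℚ S r (suc a) (2 + b) +ℚ_) (sum-cong (allSeqs r) (contrib-D a b)))

-- The normalised sums, defined by the first-step recursion; bridge below
-- shows that Q r d b = S r (b + d) b / (b + 1).

Q : ℕ → ℕ → ℕ → ℚᵘ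
Q zero    d zero    = 1ℚᵘ
Q zero    d (suc b) = 0ℚᵘ
Q (suc r) d zero    = α d 0 *ᵘ Q r d 1
Q (suc r) d (suc b) = α d (suc b) *ᵘ Q r d (2 + b) +ᵘ β (suc b) *ᵘ Q r (2 + d) b

Q-nonneg : ∀ r d b → 0ℚᵘ ≤ᵘ Q r d b
Q-nonneg zero    d zero    = *≤* (ℤ.+≤+ ℕ.z≤n)
Q-nonneg zero    d (suc b) = QuP.≤-refl
Q-nonneg (suc r) d zero    = *-nonNeg (α d 0) (Q-nonneg r d 1)
Q-nonneg (suc r) d (suc b) = QuP.+-mono-≤ {0ℚᵘ} {_} {0ℚᵘ}
  (*-nonNeg (α d (suc b)) (Q-nonneg r d (2 + b)))
  (*-nonNeg (β (suc b)) (Q-nonneg r (2 + d) b))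

Q-compare : ∀ r d b → Q r d (2 + b) ≤ᵘ Q r (2 + d) b
Q-compare zero    d b       = Q-nonneg zero (2 + d) b
Q-compare (suc r) d zero    = QuP.≤-respʳ-≃ drop-β₀
  (mix-≤ (coefficient-inequality d 0) (Q-nonneg r (2 + d) 1) (Q-compare r d 1) QuP.≤-refl)
  where
  y : ℚᵘ
  y = Q r (2 + d) 1
  drop-β₀ : α (2 + d) 0 *ᵘ y +ᵘ β 0 *ᵘ y ≃ α (2 + d) 0 *ᵘ y
  drop-β₀ = QuP.≃-trans (QuP.+-cong (QuP.≃-refl {α (2 + d) 0 *ᵘ y}) (QuP.*-zeroˡ y))
                        (QuP.+-identityʳ (α (2 + d) 0 *ᵘ y))
Q-compare (suc r) d (suc b) =
  mix-≤ (coefficient-inequality d (suc b)) (Q-nonneg r (2 + d) (2 + b))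
        (Q-compare r d (2 + b)) (Q-compare r (2 + d) b)

Q-chain : ∀ r d j t → Q r d (t * 2 + j) ≤ᵘ Q r (t * 2 + d) j
Q-chain r d j zero    = QuP.≤-refl
Q-chain r d j (suc t) = begin
  Q r d (2 + (t * 2 + j))    ≤⟨ Q-compare r d (t * 2 + j) ⟩
  Q r (2 + d) (t * 2 + j)    ≤⟨ Q-chain r (2 + d) j t ⟩
  Q r (t * 2 + (2 + d)) j    ≡⟨ cong (λ e → Q r e j) (excess-shift (t * 2) d) ⟨
  Q r (2 + (t * 2 + d)) j    ∎
  where open QuP.≤-Reasoning

upWeight-toℚᵘ : ∀ d b → toℚᵘ (weightU (b + d) b) ≃ upWeight d b
upWeight-toℚᵘ d b = QuP.≃-trans
  (QuP.≃-reflexive (cong (λ z → toℚᵘ (z / (2 + (b + d) + b))) numerator))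
  (ℚP.toℚᵘ-fromℚᵘ (upWeight d b))
  where
  excess : ∀ (B D : ℤ.ℤ) → (B ℤ.+ D ℤ.- B) ℤ.+ + 2 ≡ + 2 ℤ.+ D
  excess = ℤ-Solver.solve-∀
  numerator : (+ (b + d) ℤ.- + b) ℤ.+ + 2 ≡ + (2 + d)
  numerator = begin
    (+ (b + d) ℤ.- + b) ℤ.+ + 2    ≡⟨ cong (λ z → (z ℤ.- + b) ℤ.+ + 2) (ℤP.pos-+ b d) ⟩
    (+ b ℤ.+ + d ℤ.- + b) ℤ.+ + 2  ≡⟨ excess (+ b) (+ d) ⟩
    + 2 ℤ.+ + d                    ≡⟨ ℤP.pos-+ 2 d ⟨
    + (2 + d)                      ∎
    where open ≡-Reasoning

shift : ∀ y {u c i} → u ≃ c *ᵘ i → y *ᵘ u ≃ (c *ᵘ y) *ᵘ i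
shift y {u} {c} {i} u≃ci = begin
  y *ᵘ u           ≈⟨ QuP.*-congˡ {y} u≃ci ⟩
  y *ᵘ (c *ᵘ i)    ≈⟨ ℚᵘ*.x∙yz≈y∙xz y c i ⟩
  c *ᵘ (y *ᵘ i)    ≈⟨ QuP.*-assoc c y i ⟨
  (c *ᵘ y) *ᵘ i    ∎
  where open QuP.≃-Reasoning

-- A U step in normalised form: the factor (b + 2)/(b + 1) turns the
-- weight into α.
up-term : ∀ {s} d b q → toℚᵘ s ≃ q *ᵘ ι (2 + b) →
          toℚᵘ (weightU (b + d) b *ℚ s) ≃ (α d b *ᵘ q) *ᵘ ι (1 + b)
up-term {s} d b q s≃q = begin
  toℚᵘ (weightU (b + d) b *ℚ s)           ≈⟨ ℚP.toℚᵘ-homo-* (weightU (b + d) b) s ⟩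
  toℚᵘ (weightU (b + d) b) *ᵘ toℚᵘ s      ≈⟨ QuP.*-cong (upWeight-toℚᵘ d b) s≃q ⟩
  upWeight d b *ᵘ (q *ᵘ ι (2 + b))        ≈⟨ ℚᵘ*.x∙yz≈y∙xz (upWeight d b) q (ι (2 + b)) ⟩
  q *ᵘ (upWeight d b *ᵘ ι (2 + b))        ≈⟨ shift q coefficient ⟩
  (α d b *ᵘ q) *ᵘ ι (1 + b)               ∎
  where
  open QuP.≃-Reasoning
  cross : ∀ d b → (2 + d) * (2 + b) * ((2 + (b + d) + b) * (1 + b) * 1)
                  ≡ (2 + d) * (2 + b) * (1 + b) * ((2 + (b + d) + b) * 1)
  cross = solve-∀
  coefficient : upWeight d b *ᵘ ι (2 + b) ≃ α d b *ᵘ ι (1 + b)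
  coefficient = QuP.≃-trans (//-* (2 + d) (2 + b) (2 + (b + d) + b) 1)
    (QuP.≃-trans (//-≃ (cross d b))
                 (QuP.≃-sym (//-* ((2 + d) * (2 + b)) (1 + b) ((2 + (b + d) + b) * (1 + b)) 1)))

-- A D step in normalised form: the change of height is absorbed by β.
down-term : ∀ {s} b q → toℚᵘ s ≃ q *ᵘ ι (1 + b) → toℚᵘ s ≃ (β (1 + b) *ᵘ q) *ᵘ ι (2 + b)
down-term b q s≃q = QuP.≃-trans s≃q (shift q coefficient)
  where
  cross : ∀ b → (1 + b) * ((2 + b) * 1) ≡ (1 + b) * (2 + b) * 1
  cross = solve-∀
  coefficient : ι (1 + b) ≃ β (1 + b) *ᵘ ι (2 + b)
  coefficient = QuP.≃-trans (//-≃ (cross b)) (QuP.≃-sym (//-* (1 + b) (2 + b) (2 + b) 1))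

bridge : ∀ r d b → toℚᵘ (S r (b + d) b) ≃ Q r d b *ᵘ ι (1 + b)
bridge zero    d zero    = *≡* refl
bridge zero    d (suc b) = *≡* refl
bridge (suc r) d zero    =
  QuP.≃-trans (QuP.≃-reflexive (cong toℚᵘ (S-ground r d))) (up-term d 0 (Q r d 1) (bridge r d 1))
bridge (suc r) d (suc b) = begin
  toℚᵘ (S (suc r) (suc b + d) (suc b))
    ≡⟨ cong toℚᵘ (S-step r (suc b + d) b) ⟩
  toℚᵘ (weightU (suc b + d) (suc b) *ℚ S r (2 + b + d) (2 + b) +ℚ S r (2 + b + d) b)
    ≈⟨ ℚP.toℚᵘ-homo-+ (weightU (suc b + d) (suc b) *ℚ S r (2 + b + d) (2 + b)) (S r (2 + b + d) b) ⟩
  toℚᵘ (weightU (suc b + d) (suc b) *ℚ S r (2 + b + d) (2 + b)) +ᵘ toℚᵘ (S r (2 + b + d) b)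
    ≈⟨ QuP.+-cong (up-term d (suc b) (Q r d (2 + b)) (bridge r d (2 + b)))
                    (down-term b (Q r (2 + d) b) down-bridge) ⟩
  (α d (suc b) *ᵘ Q r d (2 + b)) *ᵘ ι (2 + b) +ᵘ (β (suc b) *ᵘ Q r (2 + d) b) *ᵘ ι (2 + b)
    ≈⟨ QuP.*-distribʳ-+ (ι (2 + b)) (α d (suc b) *ᵘ Q r d (2 + b)) (β (suc b) *ᵘ Q r (2 + d) b) ⟨
  Q (suc r) d (suc b) *ᵘ ι (2 + b) ∎
  where
  open QuP.≃-Reasoning
  down-bridge : toℚᵘ (S r (2 + (b + d)) b) ≃ Q r (2 + d) b *ᵘ ι (1 + b)
  down-bridge = subst (λ a → toℚᵘ (S r a b) ≃ Q r (2 + d) b *ᵘ ι (1 + b))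
                      (sym (excess-shift b d)) (bridge r (2 + d) b)

p≡S : ∀ ℓ m N → ℓ ≤ N → p ℓ m N ≡ S (N ∸ ℓ) ℓ m
p≡S ℓ m N ℓ≤N with ℓ ℕ.≤? N
... | yes _   = refl
... | no ℓ≰N = ⊥-elim (ℓ≰N ℓ≤N)

p-normalised : ∀ ℓ m d N → ℓ ≡ m + d → ℓ ≤ N →
               toℚᵘ (p ℓ m N *ℚ (+ 1 / suc m)) ≃ Q (N ∸ ℓ) d m
p-normalised ℓ m d N refl ℓ≤N = begin
  toℚᵘ (p ℓ m N *ℚ (+ 1 / suc m))          ≈⟨ ℚP.toℚᵘ-homo-* (p ℓ m N) (+ 1 / suc m) ⟩
  toℚᵘ (p ℓ m N) *ᵘ toℚᵘ (+ 1 / suc m)     ≈⟨ QuP.*-cong p≃Q (ℚP.toℚᵘ-fromℚᵘ (1 // suc m)) ⟩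
  (Q r d m *ᵘ ι (suc m)) *ᵘ 1 // suc m      ≈⟨ QuP.*-assoc (Q r d m) (ι (suc m)) (1 // suc m) ⟩
  Q r d m *ᵘ (ι (suc m) *ᵘ 1 // suc m)      ≈⟨ QuP.*-congˡ {Q r d m} inverse ⟩
  Q r d m *ᵘ 1ℚᵘ                            ≈⟨ QuP.*-identityʳ (Q r d m) ⟩
  Q r d m                                   ∎
  where
  open QuP.≃-Reasoning
  r : ℕ
  r = N ∸ ℓ
  p≃Q : toℚᵘ (p ℓ m N) ≃ Q r d m *ᵘ ι (suc m)
  p≃Q = QuP.≃-trans (QuP.≃-reflexive (cong toℚᵘ (p≡S ℓ m N ℓ≤N))) (bridge r d m)
  cross : ∀ m → suc m * 1 * 1 ≡ 1 * (1 * suc m)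
  cross = solve-∀
  inverse : ι (suc m) *ᵘ 1 // suc m ≃ 1ℚᵘ
  inverse = QuP.≃-trans (//-* (suc m) 1 1 (suc m)) (//-≃ (cross m))

lemma4p5 : (ℓ j k n : ℕ) → j < k → k ≤ ℓ → ℓ ≤ 2 * n → 2 ∣ (k ∸ j) →
    p ℓ k (2 * n) *ℚ (+ 1 / suc k) ≤ℚ p ℓ j (2 * n) *ℚ (+ 1 / suc j)
lemma4p5 ℓ j k n j<k k≤ℓ ℓ≤2n (divides t k-j≡2t) = ℚP.toℚᵘ-cancel-≤ (begin
  toℚᵘ (p ℓ k (2 * n) *ℚ (+ 1 / suc k))   ≃⟨ p-normalised ℓ k d (2 * n) ℓ≡k+d ℓ≤2n ⟩
  Q r d k                                  ≡⟨ cong (Q r d) k≡2t+j ⟩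
  Q r d (t * 2 + j)                        ≤⟨ Q-chain r d j t ⟩
  Q r (t * 2 + d) j                        ≃⟨ p-normalised ℓ j (t * 2 + d) (2 * n) ℓ≡j+2t+d ℓ≤2n ⟨
  toℚᵘ (p ℓ j (2 * n) *ℚ (+ 1 / suc j))   ∎)
  where
  open QuP.≤-Reasoning
  r d : ℕ
  r = 2 * n ∸ ℓ
  d = ℓ ∸ k
  ℓ≡k+d : ℓ ≡ k + d
  ℓ≡k+d = sym (ℕP.m+[n∸m]≡n k≤ℓ)
  k≡2t+j : k ≡ t * 2 + j
  k≡2t+j = trans (sym (ℕP.m∸n+n≡m (ℕP.<⇒≤ j<k))) (cong (_+ j) k-j≡2t)
  regroup : ∀ x j d → x + j + d ≡ j + (x + d)
  regroup = solve-∀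
  ℓ≡j+2t+d : ℓ ≡ j + (t * 2 + d)
  ℓ≡j+2t+d = trans ℓ≡k+d (trans (cong (_+ d) k≡2t+j) (regroup (t * 2) j d))
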